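{- For every $n\geq 0$, the $\mathbf{3}$-free naturally labelled posets on $[n]$ are in bijection with the Stanley graphs on vertex set $[n]$ (via the map sending a poset to its Hasse diagram, regarded as a graph on $[n]$).
   Context: A partial order $\preceq$ on $[n]$ is naturally labelled if $x\prec y$ implies $x<y$; it is $\mathbf{3}$-free if it has no chain $x\prec y\prec z$. A Stanley graph is a (simple) graph with vertex set $[n]$ in which no vertex $v$ has both a neighbour $u<v$ and a neighbour $u>v$. -}

module Defs where

open import Data.Nat using (ℕ)
open import Data.Fin using (Fin; _<_)
open import Data.Bool using (Bool; T)
open import Data.Product using (Σ; _×_; ∃-syntax)
open import Data.Sum using (_⊎_)
open import Relation.Nullary using (¬_)
open import Relation.Binary.PropositionalEquality using (_≡_)
open import Function.Bundles using (_⇔_)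

-- The ground set [n] is modelled by Fin n with its natural order _<_.

record Poset (n : ℕ) : Set where
  field
    leq     : Fin n → Fin n → Bool
    refl'   : ∀ x → T (leq x x)
    antisym : ∀ x y → T (leq x y) → T (leq y x) → x ≡ y
    trans'  : ∀ x y z → T (leq x y) → T (leq y z) → T (leq x z)

_≺[_]_ : ∀ {n} → Fin n → Poset n → Fin n → Set
x ≺[ P ] y = T (Poset.leq P x y) × ¬ (x ≡ y)

NaturallyLabelled : ∀ {n} → Poset n → Set
NaturallyLabelled {n} P = ∀ (x y : Fin n) → x ≺[ P ] y → x < y

ThreeFree : ∀ {n} → Poset n → Set
ThreeFree {n} P = ¬ (∃[ x ] ∃[ y ] ∃[ z ] (x ≺[ P ] y × y ≺[ P ] z))

Covers : ∀ {n} → Poset n → Fin n → Fin n → Set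
Covers {n} P x y = x ≺[ P ] y × ¬ (∃[ z ] (x ≺[ P ] z × z ≺[ P ] y))

HasseEdge : ∀ {n} → Poset n → Fin n → Fin n → Set
HasseEdge P x y = Covers P x y ⊎ Covers P y x

record Graph (n : ℕ) : Set where
  field
    adj     : Fin n → Fin n → Bool
    sym'    : ∀ x y → T (adj x y) → T (adj y x)
    irrefl' : ∀ x → ¬ T (adj x x)

Stanley : ∀ {n} → Graph n → Set
Stanley {n} G =
  ¬ (∃[ v ] ∃[ u ] ∃[ w ]
       (u < v × v < w × T (Graph.adj G v u) × T (Graph.adj G v w)))

IsHasseOf : ∀ {n} → Graph n → Poset n → Set
IsHasseOf {n} G P = ∀ (x y : Fin n) → T (Graph.adj G x y) ⇔ HasseEdge P x y

SamePoset : ∀ {n} → Poset n → Poset n → Set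
SamePoset {n} P Q = ∀ (x y : Fin n) → T (Poset.leq P x y) ⇔ T (Poset.leq Q x y)

SameGraph : ∀ {n} → Graph n → Graph n → Set
SameGraph {n} G H = ∀ (x y : Fin n) → T (Graph.adj G x y) ⇔ T (Graph.adj H x y)

{-# OPTIONS --safe #-}
module Submission where

-- For a 3-free poset every strict relation x ≺ y is a cover, so its Hasse
-- diagram is its comparability graph. A natural labelling orients every
-- edge upwards, so a vertex with a smaller and a larger neighbour would be
-- the middle of a chain of length 3; conversely the upward orientation of
-- a Stanley graph is transitive for the same reason, and the poset is
-- recovered from the Hasse diagram by orienting each edge upwards.

open import Defs
open import Data.Nat using (ℕ)
open import Data.Product using (Σ; _×_; _,_; proj₁; proj₂)
open import Data.Sum using (_⊎_; inj₁; inj₂; [_,_]; swap)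
import Data.Sum as Sum
open import Data.Sum.Function.Propositional using (_⊎-⇔_)
open import Data.Bool using (Bool; true; false; T; _∨_)
open import Data.Bool.Properties using (T-∨)
open import Data.Fin using (Fin; _<_)
open import Data.Fin.Properties using (_≟_; _<?_; <-asym; <-irrefl; <-cmp)
open import Data.Empty using (⊥; ⊥-elim)
open import Data.Unit using (tt)
open import Function using (_∘_; id; const)
open import Function.Bundles using (_⇔_; mk⇔; Equivalence)
open import Function.Related.Propositional using (module EquationalReasoning)
open import Function.Properties.Equivalence using () renaming (sym to ⇔-sym)
open import Relation.Nullary using (¬_; yes; no)
open import Relation.Binary using (tri<; tri≈; tri>)
open import Relation.Binary.PropositionalEquality using (_≡_; refl; sym)

open Equivalence using (to; from)

module _ {n : ℕ} (P : Poset n) where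
  open Poset P

  ≺-irrefl : ∀ {x} → ¬ x ≺[ P ] x
  ≺-irrefl (_ , x≢x) = x≢x refl

  Comparable : Fin n → Fin n → Set
  Comparable x y = x ≺[ P ] y ⊎ y ≺[ P ] x

  comparable? : Fin n → Fin n → Bool
  comparable? x y with x ≟ y
  ... | yes _ = false
  ... | no _  = leq x y ∨ leq y x

  T-comparable? : ∀ x y → T (comparable? x y) ⇔ Comparable x y
  T-comparable? x y with x ≟ y
  ... | yes refl = mk⇔ (λ ()) [ ≺-irrefl , ≺-irrefl ]
  ... | no x≢y   = mk⇔ (Sum.map (_, x≢y) (_, x≢y ∘ sym) ∘ to T-∨)
                       (from T-∨ ∘ Sum.map proj₁ proj₁)

  comparabilityGraph : Graph n
  comparabilityGraph = record
    { adj     = comparable?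
    ; sym'    = λ x y → from (T-comparable? y x) ∘ swap ∘ to (T-comparable? x y)
    ; irrefl' = λ x → [ ≺-irrefl , ≺-irrefl ] ∘ to (T-comparable? x x)
    }

  module _ (threeFree : ThreeFree P) where

    ≺⇒Covers : ∀ {x y} → x ≺[ P ] y → Covers P x y
    ≺⇒Covers {x} {y} x≺y =
      x≺y , λ (z , x≺z , z≺y) → threeFree (x , z , y , x≺z , z≺y)

    HasseEdge⇔Comparable : ∀ x y → HasseEdge P x y ⇔ Comparable x y
    HasseEdge⇔Comparable x y =
      mk⇔ (Sum.map proj₁ proj₁) (Sum.map ≺⇒Covers ≺⇒Covers)

    comparabilityGraph-isHasse : IsHasseOf comparabilityGraph P
    comparabilityGraph-isHasse x y = begin
      T (comparable? x y) ∼⟨ T-comparable? x y ⟩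
      Comparable x y      ∼⟨ ⇔-sym (HasseEdge⇔Comparable x y) ⟩
      HasseEdge P x y     ∎
      where open EquationalReasoning

    comparabilityGraph-stanley : NaturallyLabelled P → Stanley comparabilityGraph
    comparabilityGraph-stanley natural (v , u , w , u<v , v<w , vu , vw)
      with to (T-comparable? v u) vu | to (T-comparable? v w) vw
    ... | inj₁ v≺u | _        = <-asym u<v (natural v u v≺u)
    ... | inj₂ u≺v | inj₁ v≺w = threeFree (u , v , w , u≺v , v≺w)
    ... | inj₂ _   | inj₂ w≺v = <-asym v<w (natural w v w≺v)

HasseEdge⇒Covers : ∀ {n} (P : Poset n) → NaturallyLabelled P →
  ∀ {x y} → x < y → HasseEdge P x y → Covers P x y
HasseEdge⇒Covers P natural x<y (inj₁ x⋖y)       = x⋖y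
HasseEdge⇒Covers P natural x<y (inj₂ (y≺x , _)) =
  ⊥-elim (<-asym x<y (natural _ _ y≺x))

HasseEdge⊆⇒leq⊆ : ∀ {n} (P Q : Poset n) →
  ThreeFree P → NaturallyLabelled P → NaturallyLabelled Q →
  (∀ x y → HasseEdge P x y → HasseEdge Q x y) →
  ∀ x y → T (Poset.leq P x y) → T (Poset.leq Q x y)
HasseEdge⊆⇒leq⊆ P Q threeFreeP naturalP naturalQ edge⊆ x y x≤y with x ≟ y
... | yes refl = Poset.refl' Q x
... | no x≢y   = proj₁ (proj₁ (HasseEdge⇒Covers Q naturalQ x<y edgeQ))
  where
  x≺y : x ≺[ P ] y
  x≺y = x≤y , x≢y
  x<y : x < y
  x<y = naturalP x y x≺y
  edgeQ : HasseEdge Q x y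
  edgeQ = edge⊆ x y (inj₁ (≺⇒Covers P threeFreeP x≺y))

sameHasse⇒samePoset : ∀ {n} (P Q : Poset n) →
  ThreeFree P → NaturallyLabelled P → ThreeFree Q → NaturallyLabelled Q →
  (G : Graph n) → IsHasseOf G P → IsHasseOf G Q → SamePoset P Q
sameHasse⇒samePoset P Q threeFreeP naturalP threeFreeQ naturalQ G hasseP hasseQ x y =
  mk⇔ (HasseEdge⊆⇒leq⊆ P Q threeFreeP naturalP naturalQ
         (λ u v → to (hasseQ u v) ∘ from (hasseP u v)) x y)
      (HasseEdge⊆⇒leq⊆ Q P threeFreeQ naturalQ naturalP
         (λ u v → to (hasseP u v) ∘ from (hasseQ u v)) x y)

module _ {n : ℕ} (G : Graph n) where
  open Graph G

  UpEdge : Fin n → Fin n → Set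
  UpEdge x y = x < y × T (adj x y)

  adj⇔UpEdge⊎UpEdge : ∀ x y → T (adj x y) ⇔ (UpEdge x y ⊎ UpEdge y x)
  adj⇔UpEdge⊎UpEdge x y = mk⇔ orient [ proj₂ , sym' y x ∘ proj₂ ]
    where
    orient : T (adj x y) → UpEdge x y ⊎ UpEdge y x
    orient xy with <-cmp x y
    ... | tri< x<y _ _  = inj₁ (x<y , xy)
    ... | tri≈ _ refl _ = ⊥-elim (irrefl' x xy)
    ... | tri> _ _ y<x  = inj₂ (y<x , sym' x y xy)

  Stanley⇒¬UpPath : Stanley G → ∀ {x y z} → UpEdge x y → UpEdge y z → ⊥
  Stanley⇒¬UpPath stanley {x} {y} {z} (x<y , xy) (y<z , yz) =
    stanley (y , x , z , x<y , y<z , sym' x y xy , yz)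

  upward? : Fin n → Fin n → Bool
  upward? x y with x ≟ y | x <? y
  ... | yes _ | _     = true
  ... | no _  | yes _ = adj x y
  ... | no _  | no _  = false

  T-upward? : ∀ x y → T (upward? x y) ⇔ (x ≡ y ⊎ UpEdge x y)
  T-upward? x y with x ≟ y | x <? y
  ... | yes x≡y | _       = mk⇔ (const (inj₁ x≡y)) (const tt)
  ... | no x≢y  | yes x<y = mk⇔ (inj₂ ∘ (x<y ,_)) [ ⊥-elim ∘ x≢y , proj₂ ]
  ... | no x≢y  | no x≮y  = mk⇔ (λ ()) [ x≢y , x≮y ∘ proj₁ ]

  upward?-antisym : ∀ x y → T (upward? x y) → T (upward? y x) → x ≡ y
  upward?-antisym x y x≤y y≤x with to (T-upward? x y) x≤y | to (T-upward? y x) y≤x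
  ... | inj₁ x≡y       | _              = x≡y
  ... | inj₂ _         | inj₁ y≡x       = sym y≡x
  ... | inj₂ (x<y , _) | inj₂ (y<x , _) = ⊥-elim (<-asym x<y y<x)

  upward?-trans : Stanley G →
    ∀ x y z → T (upward? x y) → T (upward? y z) → T (upward? x z)
  upward?-trans stanley x y z x≤y y≤z
    with to (T-upward? x y) x≤y | to (T-upward? y z) y≤z
  ... | inj₁ refl | _         = y≤z
  ... | inj₂ _    | inj₁ refl = x≤y
  ... | inj₂ xy   | inj₂ yz   = ⊥-elim (Stanley⇒¬UpPath stanley xy yz)

  module _ (stanley : Stanley G) where

    upwardPoset : Poset n
    upwardPoset = record
      { leq     = upward?
      ; refl'   = λ x → from (T-upward? x x) (inj₁ refl)
      ; antisym = upward?-antisym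
      ; trans'  = upward?-trans stanley
      }

    ≺⇔UpEdge : ∀ x y → x ≺[ upwardPoset ] y ⇔ UpEdge x y
    ≺⇔UpEdge x y = mk⇔
      (λ (x≤y , x≢y) → [ ⊥-elim ∘ x≢y , id ] (to (T-upward? x y) x≤y))
      (λ up → from (T-upward? x y) (inj₂ up) , λ x≡y → <-irrefl x≡y (proj₁ up))

    upwardPoset-threeFree : ThreeFree upwardPoset
    upwardPoset-threeFree (x , y , z , x≺y , y≺z) =
      Stanley⇒¬UpPath stanley (to (≺⇔UpEdge x y) x≺y) (to (≺⇔UpEdge y z) y≺z)

    upwardPoset-naturallyLabelled : NaturallyLabelled upwardPoset
    upwardPoset-naturallyLabelled x y = proj₁ ∘ to (≺⇔UpEdge x y)

    upwardPoset-isHasse : IsHasseOf G upwardPoset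
    upwardPoset-isHasse x y = begin
      T (adj x y)                ∼⟨ adj⇔UpEdge⊎UpEdge x y ⟩
      (UpEdge x y ⊎ UpEdge y x)  ∼⟨ ⇔-sym (≺⇔UpEdge x y ⊎-⇔ ≺⇔UpEdge y x) ⟩
      Comparable upwardPoset x y ∼⟨ ⇔-sym (HasseEdge⇔Comparable upwardPoset upwardPoset-threeFree x y) ⟩
      HasseEdge upwardPoset x y  ∎
      where open EquationalReasoning

proposition2p2 : (n : ℕ) →
    -- the Hasse diagram of a 3-free naturally labelled poset is a Stanley graph
    ((P : Poset n) → ThreeFree P → NaturallyLabelled P →
      Σ (Graph n) (λ G → IsHasseOf G P × Stanley G))
    -- the map P ↦ Hasse diagram is injective on 3-free naturally labelled posets
    × ((P Q : Poset n) → ThreeFree P → NaturallyLabelled P →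
       ThreeFree Q → NaturallyLabelled Q →
       (G : Graph n) → IsHasseOf G P → IsHasseOf G Q → SamePoset P Q)
    -- and surjective onto Stanley graphs
    × ((G : Graph n) → Stanley G →
       Σ (Poset n) (λ P → ThreeFree P × NaturallyLabelled P × IsHasseOf G P))
proposition2p2 n =
  (λ P threeFree natural →
    comparabilityGraph P ,
    comparabilityGraph-isHasse P threeFree ,
    comparabilityGraph-stanley P threeFree natural) ,
  sameHasse⇒samePoset ,
  (λ G stanley →
    upwardPoset G stanley ,
    upwardPoset-threeFree G stanley ,
    upwardPoset-naturallyLabelled G stanley ,
    upwardPoset-isHasse G stanley)
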